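{- Let $k\ge 1$ and $0\le r<k$ be integers and let $n\ge 1$. Then $$\sum_{j=0}^{n}(-1)^j\binom{r+1}{j}F^{(k)}_{k(n-j)+r}(x)=x^{r+1}F^{(k)}_{kn-1}(x),$$ and for every integer $i$ with $0<i<k+n$, $$\sum_{j=0}^{n-1}(-1)^{n-1-j}\binom{i-k+r}{n-1-j}x^kF^{(k)}_{kj+r}(x)=x^{r+i}F^{(k)}_{kn-i}(x).$$
   Context: Binomial coefficients are generalized: for an integer $a$ (possibly negative) and an integer $m$, $\binom{a}{m}=\frac{a(a-1)\cdots(a-m+1)}{m!}$ if $m\ge 0$ and $\binom{a}{m}=0$ if $m<0$. For a positive integer $k$ and integer $N\ge 0$, the generalized Fibonacci polynomial is $F^{(k)}_N(x)=\sum_{j=0}^{\lfloor N/k\rfloor}\binom{N-(k-1)j}{j}x^{N-kj}$; equivalently $F^{(k)}_N(x)=x^N$ for $0\le N<k$ and $F^{(k)}_N(x)=xF^{(k)}_{N-1}(x)+F^{(k)}_{N-k}(x)$ for $N\ge k$. -}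

module Defs where

open import Level using (Level)
open import Algebra.Bundles using (CommutativeRing; Semiring)
open import Data.Nat as ℕ using (ℕ; zero; suc; _∸_; _/_; _!; NonZero)
open import Data.Nat.Properties using (_!≢0)
open import Data.Nat.Combinatorics using (_C_)
open import Data.Integer as ℤ using (ℤ; +_; -[1+_])
open import Data.Integer.DivMod using (_/ℕ_)

-- Generalised binomial coefficient  binom(a, m) = a(a-1)...(a-m+1) / m!
-- for an integer a and a natural number m (for m < 0 it is 0; in the
-- statement all lower indices are >= 0, so only m : ℕ is needed).
-- The division is exact (m! divides any product of m consecutive integers).
fallingℤ : ℤ → ℕ → ℤ
fallingℤ a zero    = ℤ.+ 1
fallingℤ a (suc m) = fallingℤ a m ℤ.* (a ℤ.- + m)

binomℤ : ℤ → ℕ → ℤ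
binomℤ a m = fallingℤ a m /ℕ (m !)
  where instance _ = m !≢0

module RingDefs {c ℓ : Level} (R : CommutativeRing c ℓ) where
  open CommutativeRing R
  open import Algebra.Definitions.RawSemiring (Semiring.rawSemiring semiring) using (_×_)

  open import Algebra.Definitions.RawSemiring (Semiring.rawSemiring semiring) using (_^_) public

  ι : ℤ → Carrier
  ι (+ n)    = n × 1#
  ι -[1+ n ] = - (suc n × 1#)

  -- Σ_{j=0}^{n} f j  (upper bound inclusive)
  sumTo : ℕ → (ℕ → Carrier) → Carrier
  sumTo zero    f = f 0
  sumTo (suc n) f = sumTo n f + f (suc n)

  -- For 0 ≤ j ≤ ⌊N/k⌋ we have N-(k-1)j ≥ j ≥ 0 and N-kj ≥ 0, so the
  -- truncated subtractions ∸ below never truncate.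
  F : (k : ℕ) .{{_ : NonZero k}} → ℕ → Carrier → Carrier
  F k N x = sumTo (N / k) (λ j → ((N ∸ (k ∸ 1) ℕ.* j) C j) × 1# * x ^ (N ∸ k ℕ.* j))

-- For a sequence G and an integer a let W_a(G, n) = Σ_{m ≤ n} (-1)^m C(a, m) G(n - m).
-- Pascal's rule turns into W_{a+1}(G, n+1) = W_a(G, n+1) - W_a(G, n), and W_0(G, n) = G(n).
-- For G(t) = F_{kt+r} the recurrence F_{M+k} = x F_{M+k-1} + F_M shows that x^s F_{kn+r-s}
-- obeys the same rule, so W_s(G, n) = x^s F_{kn+r-s} whenever s ≤ r + n, by climbing from
-- s = 0; the first identity is the case s = r + 1. Read backwards, the second identity is
-- x^k W_{i-k+r}(G, n-1): for i - k + r ≥ 0 it is the previous formula times x^k, and for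
-- negative i - k + r it follows by running the rule downwards from 0 as
-- W_a(n+1) = W_{a+1}(n+1) + W_a(n). Pascal's rule for the generalised binomial coefficients
-- needs m! to divide the falling factorial, which follows by induction over ℤ in both
-- directions from the same rule for falling factorials.
module Submission where

open import Defs
open import Level using (Level)
open import Algebra.Bundles using (CommutativeRing)
import Data.Nat as ℕ
import Data.Nat.Properties as ℕP
open import Data.Nat.Properties using (_!≢0)
import Data.Nat.DivMod as ℕD

module Binomialℤ where
  open ℕ using (zero; suc; _!)
  open import Data.Integer
    using (ℤ; +_; -[1+_]; 0ℤ; 1ℤ; _+_; _-_; _*_; -_) renaming (suc to sucℤ)
  import Data.Integer.Properties as ℤP
  open import Data.Integer.Divisibility.Signed
    using (_∣_; divides; ∣-refl; ∣-trans; ∣-reflexive; *-monoʳ-∣; ∣m∣n⇒∣m+n; ∣m+n∣n⇒∣m)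
  open import Data.Integer.DivMod using (_/ℕ_)
  open import Data.Integer.Tactic.RingSolver using (solve-∀)
  open import Relation.Binary.PropositionalEquality using (_≡_; refl; sym; trans; cong; cong₂; module ≡-Reasoning)

  ℤ-induction : (P : ℤ → Set) → P 0ℤ → (∀ a → P a → P (sucℤ a)) → (∀ a → P (sucℤ a) → P a) →
                ∀ a → P a
  ℤ-induction P P0 up down (+ zero)     = P0
  ℤ-induction P P0 up down (+ suc n)    = up (+ n) (ℤ-induction P P0 up down (+ n))
  ℤ-induction P P0 up down -[1+ zero ]  = down -[1+ zero ] P0
  ℤ-induction P P0 up down -[1+ suc n ] = down -[1+ suc n ] (ℤ-induction P P0 up down -[1+ n ])

  fallingℤ-pascal : ∀ a m → fallingℤ (sucℤ a) (suc m) ≡ fallingℤ a (suc m) + + suc m * fallingℤ a m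
  fallingℤ-pascal a zero = base a (+ 0)
    where
    base : ∀ a z → 1ℤ * ((1ℤ + a) - z) ≡ 1ℤ * (a - z) + 1ℤ * 1ℤ
    base = solve-∀
  fallingℤ-pascal a (suc m) =
    trans (cong (_* (sucℤ a - + suc m)) (fallingℤ-pascal a m)) (step a (+ m) (fallingℤ a m))
    where
    step : ∀ a m f → (f * (a - m) + (1ℤ + m) * f) * ((1ℤ + a) - (1ℤ + m))
                   ≡ f * (a - m) * (a - (1ℤ + m)) + (1ℤ + (1ℤ + m)) * (f * (a - m))
    step = solve-∀

  fallingℤ[0,1+m]≡0 : ∀ m → fallingℤ 0ℤ (suc m) ≡ 0ℤ
  fallingℤ[0,1+m]≡0 zero    = refl
  fallingℤ[0,1+m]≡0 (suc m) = cong (_* -[1+ m ]) (fallingℤ[0,1+m]≡0 m)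

  m!∣fallingℤ : ∀ m a → + (m !) ∣ fallingℤ a m
  m!∣fallingℤ zero    a = ∣-refl
  m!∣fallingℤ (suc m) = ℤ-induction (λ a → + (suc m !) ∣ fallingℤ a (suc m))
    (divides 0ℤ (fallingℤ[0,1+m]≡0 m))
    (λ a d∣f → ∣-trans (∣m∣n⇒∣m+n d∣f (d∣pascal-term a)) (∣-reflexive (sym (fallingℤ-pascal a m))))
    (λ a d∣f → ∣m+n∣n⇒∣m (∣-trans d∣f (∣-reflexive (fallingℤ-pascal a m))) (d∣pascal-term a))
    where
    d∣pascal-term : ∀ a → + (suc m !) ∣ + suc m * fallingℤ a m
    d∣pascal-term a = ∣-trans (∣-reflexive (ℤP.pos-* (suc m) (m !))) (*-monoʳ-∣ (+ suc m) (m!∣fallingℤ m a))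

  *-/ℕ-cancel : ∀ q d .{{_ : ℕ.NonZero d}} → (q * + d) /ℕ d ≡ q
  *-/ℕ-cancel (+ n)    d rewrite sym (ℤP.pos-* n d) = cong +_ (ℕD.m*n/n≡m n d)
  *-/ℕ-cancel -[1+ n ] d@(suc e) with ℕ.suc (e ℕ.+ n ℕ.* suc e) ℕ.% d | ℕD.m*n%n≡0 (suc n) d
  -- For a negative dividend, `/ℕ` branches on the remainder, which is 0 here.
  ... | .0 | refl = cong (λ z → - (+ z)) (ℕD.m*n/n≡m (suc n) d)

  binomℤ-*-! : ∀ a m → binomℤ a m * + (m !) ≡ fallingℤ a m
  binomℤ-*-! a m with m!∣fallingℤ m a
  ... | divides q eq = trans (cong (λ f → (f /ℕ m !) * + (m !)) eq)
                             (trans (cong (_* + (m !)) (*-/ℕ-cancel q (m !))) (sym eq))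
    where instance _ = m !≢0

  binomℤ-pascal : ∀ a m → binomℤ (sucℤ a) (suc m) ≡ binomℤ a (suc m) + binomℤ a m
  binomℤ-pascal a m = ℤP.*-cancelʳ-≡ _ _ (+ (suc m !)) (begin
    binomℤ (sucℤ a) (suc m) * + (suc m !)                   ≡⟨ binomℤ-*-! (sucℤ a) (suc m) ⟩
    fallingℤ (sucℤ a) (suc m)                               ≡⟨ fallingℤ-pascal a m ⟩
    fallingℤ a (suc m) + + suc m * fallingℤ a m              ≡⟨ cong₂ (λ u v → u + + suc m * v) (sym (binomℤ-*-! a (suc m))) (sym (binomℤ-*-! a m)) ⟩
    b₁ * + (suc m !) + + suc m * (b₀ * + (m !))               ≡⟨ cong (λ z → b₁ * z + + suc m * (b₀ * + (m !))) (ℤP.pos-* (suc m) (m !)) ⟩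
    b₁ * (+ suc m * + (m !)) + + suc m * (b₀ * + (m !))       ≡⟨ regroup b₁ b₀ (+ suc m) (+ (m !)) ⟩
    (b₁ + b₀) * (+ suc m * + (m !))                          ≡⟨ cong ((b₁ + b₀) *_) (sym (ℤP.pos-* (suc m) (m !))) ⟩
    (b₁ + b₀) * + (suc m !)                                  ∎)
    where
    open ≡-Reasoning
    instance _ = suc m !≢0
    b₁ = binomℤ a (suc m)
    b₀ = binomℤ a m
    regroup : ∀ x y s f → x * (s * f) + s * (y * f) ≡ (x + y) * (s * f)
    regroup = solve-∀

  binomℤ[0,1+m]≡0 : ∀ m → binomℤ 0ℤ (suc m) ≡ 0ℤ
  binomℤ[0,1+m]≡0 m = trans (cong (_/ℕ (suc m !)) (fallingℤ[0,1+m]≡0 m)) (cong +_ (ℕD.0/n≡0 (suc m !)))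
    where instance _ = suc m !≢0

module FibonacciArithmetic (k′ : ℕ.ℕ) where
  open ℕ using (ℕ; zero; suc; _+_; _*_; _∸_; _<_; _≤_; s≤s; _/_)
  open import Data.Nat.Combinatorics using (_C_; k>n⇒nCk≡0; nCk+nC[k+1]≡[n+1]C[k+1])
  open import Relation.Binary.PropositionalEquality using (_≡_; refl; sym; trans; cong; cong₂; subst; module ≡-Reasoning)
  open import Relation.Nullary using (yes; no; contradiction)

  k : ℕ
  k = suc k′

  coeff : ℕ → ℕ → ℕ
  coeff N j = (N ∸ k′ * j) C j

  expo : ℕ → ℕ → ℕ
  expo N j = N ∸ k * j

  [m+a]∸a*[1+j]≡m∸a*j : ∀ m a j → (m + a) ∸ a * suc j ≡ m ∸ a * j
  [m+a]∸a*[1+j]≡m∸a*j m a j =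
    trans (cong₂ _∸_ (ℕP.+-comm m a) (ℕP.*-suc a j)) (ℕP.[m+n]∸[m+o]≡n∸o a m (a * j))

  coeff-beyond : ∀ N j → N / k < j → coeff N j ≡ 0
  coeff-beyond N (suc j) N/k<j = k>n⇒nCk≡0 (ℕP.m<n+o⇒m∸n<o N (k′ * suc j) N<k′j+j)
    where
    N<k′j+j : N < k′ * suc j + suc j
    N<k′j+j = subst (N <_) (trans (ℕP.*-suc (suc j) k′) (trans (cong (suc j +_) (ℕP.*-comm (suc j) k′)) (ℕP.+-comm (suc j) _)))
                (ℕP.≰⇒> (λ jk≤N → ℕP.<⇒≱ N/k<j (subst (_≤ N / k) (ℕD.m*n/n≡m (suc j) k) (ℕD./-monoˡ-≤ k jk≤N))))

  coeff-pascal : ∀ M j → coeff (M + k) (suc j) ≡ coeff (M + k′) (suc j) + coeff M j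
  coeff-pascal M j
    rewrite ℕP.+-suc M k′ | [m+a]∸a*[1+j]≡m∸a*j (suc M) k′ j | [m+a]∸a*[1+j]≡m∸a*j M k′ j
    with k′ * j ℕP.≤? M
  ... | yes k′j≤M rewrite ℕP.+-∸-assoc 1 k′j≤M =
    trans (sym (nCk+nC[k+1]≡[n+1]C[k+1] (M ∸ k′ * j) j)) (ℕP.+-comm ((M ∸ k′ * j) C j) _)
  -- Here M < k′ j, so all three coefficients have upper index 0 (and j > 0).
  ... | no k′j≰M rewrite ℕP.m≤n⇒m∸n≡0 (ℕP.≰⇒> k′j≰M) | ℕP.m≤n⇒m∸n≡0 (ℕP.<⇒≤ (ℕP.≰⇒> k′j≰M)) =
    sym (0Cj≡0 j (ℕP.≰⇒> k′j≰M))
    where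
    0Cj≡0 : ∀ j → M < k′ * j → 0 C j ≡ 0
    0Cj≡0 zero    M<0 = contradiction (subst (M <_) (ℕP.*-zeroʳ k′) M<0) ℕP.n≮0
    0Cj≡0 (suc j) _   = refl

  expo-shift : ∀ M j → expo (M + k) (suc j) ≡ expo M j
  expo-shift M j = [m+a]∸a*[1+j]≡m∸a*j M k j

  expo-shift′ : ∀ M j → expo (M + k′) (suc j) ≡ expo M j ∸ 1
  expo-shift′ M j = begin
    (M + k′) ∸ k * suc j           ≡⟨ cong ((M + k′) ∸_) (trans (ℕP.*-suc k j) (ℕP.+-comm 1 (k′ + k * j))) ⟩
    (M + k′) ∸ ((k′ + k * j) + 1)  ≡⟨ ℕP.∸-+-assoc (M + k′) (k′ + k * j) 1 ⟨
    ((M + k′) ∸ (k′ + k * j)) ∸ 1  ≡⟨ cong (λ m → (m ∸ (k′ + k * j)) ∸ 1) (ℕP.+-comm M k′) ⟩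
    ((k′ + M) ∸ (k′ + k * j)) ∸ 1  ≡⟨ cong (_∸ 1) (ℕP.[m+n]∸[m+o]≡n∸o k′ M (k * j)) ⟩
    (M ∸ k * j) ∸ 1                ∎
    where open ≡-Reasoning

  coeff-expo-0 : ∀ M j → expo M j ≡ 0 → coeff (M + k′) (suc j) ≡ 0
  coeff-expo-0 M j e≡0 rewrite [m+a]∸a*[1+j]≡m∸a*j M k′ j =
    k>n⇒nCk≡0 (s≤s (subst (M ∸ k′ * j ≤_) (ℕP.m+n∸n≡m j (k′ * j)) (ℕP.∸-monoˡ-≤ (k′ * j) (ℕP.m∸n≡0⇒m≤n e≡0))))

  k*0+r≡r : ∀ r → k * 0 + r ≡ r
  k*0+r≡r r = cong (_+ r) (ℕP.*-zeroʳ k)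

  k*[1+n]+r≡k+[k*n+r] : ∀ n r → k * suc n + r ≡ k + (k * n + r)
  k*[1+n]+r≡k+[k*n+r] n r = trans (cong (_+ r) (ℕP.*-suc k n)) (ℕP.+-assoc k (k * n) r)

  k*[1+n]∸[k∸r]≡k*n+r : ∀ n r → r ≤ k → k * suc n ∸ (k ∸ r) ≡ k * n + r
  k*[1+n]∸[k∸r]≡k*n+r n r r≤k = begin
    k * suc n ∸ (k ∸ r)                 ≡⟨ cong (_∸ (k ∸ r)) (ℕP.*-suc k n) ⟩
    k + k * n ∸ (k ∸ r)                 ≡⟨ cong (λ m → m + k * n ∸ (k ∸ r)) (ℕP.m∸n+n≡m r≤k) ⟨
    k ∸ r + r + k * n ∸ (k ∸ r)         ≡⟨ cong (_∸ (k ∸ r)) (ℕP.+-assoc (k ∸ r) r (k * n)) ⟩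
    k ∸ r + (r + k * n) ∸ (k ∸ r)       ≡⟨ ℕP.m+n∸m≡n (k ∸ r) (r + k * n) ⟩
    r + k * n                           ≡⟨ ℕP.+-comm r (k * n) ⟩
    k * n + r                           ∎
    where open ≡-Reasoning

module RingSums {c ℓ : Level} (R : CommutativeRing c ℓ) where
  open CommutativeRing R
  open RingDefs R
  open import Data.Nat using (ℕ; zero; suc; _∸_; _≤_; z≤n; s≤s)
  open import Data.Integer as ℤ using (ℤ; +_; -[1+_]; _⊖_; 1ℤ) renaming (suc to sucℤ)
  import Data.Integer.Properties as ℤP
  import Relation.Binary.PropositionalEquality as P
  open import Relation.Binary.Reasoning.Setoid setoid
  open import Algebra.Properties.Ring ring using (-1*x≈-x)
  open import Algebra.Properties.AbelianGroup +-abelianGroup using (⁻¹-∙-comm; ε⁻¹≈ε)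
  open import Algebra.Properties.Semiring.Mult semiring using (_×_; ×-homo-+)
  open import Algebra.Solver.Ring.NaturalCoefficients.Default commutativeSemiring
    using (solve; _:+_; _:*_; _:=_)
  open Binomialℤ using (binomℤ-pascal; binomℤ[0,1+m]≡0)

  ι-1 : ι 1ℤ ≈ 1#
  ι-1 = +-identityʳ 1#

  ι-⊖ : ∀ m n → ι (m ⊖ n) ≈ ι (+ m) - ι (+ n)
  ι-⊖ m       zero    = sym (trans (+-congˡ ε⁻¹≈ε) (+-identityʳ _))
  ι-⊖ zero    (suc n) = sym (+-identityˡ _)
  ι-⊖ (suc m) (suc n) = begin
    ι (suc m ⊖ suc n)                 ≡⟨ P.cong ι (ℤP.[1+m]⊖[1+n]≡m⊖n m n) ⟩
    ι (m ⊖ n)                         ≈⟨ ι-⊖ m n ⟩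
    a - b                             ≈⟨ +-identityˡ (a - b) ⟨
    0# + (a - b)                      ≈⟨ +-congʳ (-‿inverseʳ 1#) ⟨
    (1# - 1#) + (a - b)               ≈⟨ solve 4 (λ o o′ a b′ → (o :+ o′) :+ (a :+ b′) := (o :+ a) :+ (o′ :+ b′)) refl 1# (- 1#) a (- b) ⟩
    (1# + a) + (- 1# - b)             ≈⟨ +-congˡ (⁻¹-∙-comm 1# b) ⟩
    (1# + a) - (1# + b)               ∎
    where
    a = ι (+ m)
    b = ι (+ n)

  ι-+ : ∀ u v → ι (u ℤ.+ v) ≈ ι u + ι v
  ι-+ (+ m)    (+ n)    = ×-homo-+ 1# m n
  ι-+ (+ m)    -[1+ n ] = ι-⊖ m (suc n)
  ι-+ -[1+ m ] (+ n)    = trans (ι-⊖ n (suc m)) (+-comm _ _)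
  ι-+ -[1+ m ] -[1+ n ] = begin
    - (suc (suc (m ℕ.+ n)) × 1#)       ≡⟨ P.cong (λ z → - (z × 1#)) (ℕP.+-suc (suc m) n) ⟨
    - ((suc m ℕ.+ suc n) × 1#)         ≈⟨ -‿cong (×-homo-+ 1# (suc m) (suc n)) ⟩
    - (suc m × 1# + suc n × 1#)        ≈⟨ ⁻¹-∙-comm _ _ ⟨
    - (suc m × 1#) - (suc n × 1#)      ∎

  binomᴿ : ℤ → ℕ → Carrier
  binomᴿ a m = ι (binomℤ a m)

  binomᴿ-pascal : ∀ a m → binomᴿ (sucℤ a) (suc m) ≈ binomᴿ a (suc m) + binomᴿ a m
  binomᴿ-pascal a m = trans (reflexive (P.cong ι (binomℤ-pascal a m))) (ι-+ (binomℤ a (suc m)) (binomℤ a m))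

  sumTo-cong : ∀ n {f g : ℕ → Carrier} → (∀ j → j ≤ n → f j ≈ g j) → sumTo n f ≈ sumTo n g
  sumTo-cong zero    f≈g = f≈g 0 z≤n
  sumTo-cong (suc n) f≈g = +-cong (sumTo-cong n (λ j j≤n → f≈g j (ℕP.m≤n⇒m≤1+n j≤n))) (f≈g (suc n) ℕP.≤-refl)

  sumTo-unfoldˡ : ∀ n (f : ℕ → Carrier) → sumTo (suc n) f ≈ f 0 + sumTo n (λ j → f (suc j))
  sumTo-unfoldˡ zero    f = refl
  sumTo-unfoldˡ (suc n) f = trans (+-congʳ (sumTo-unfoldˡ n f)) (+-assoc _ _ _)

  sumTo-distrib-+ : ∀ n (f g : ℕ → Carrier) → sumTo n (λ j → f j + g j) ≈ sumTo n f + sumTo n g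
  sumTo-distrib-+ zero    f g = refl
  sumTo-distrib-+ (suc n) f g = begin
    sumTo n (λ j → f j + g j) + (f (suc n) + g (suc n))  ≈⟨ +-congʳ (sumTo-distrib-+ n f g) ⟩
    (sumTo n f + sumTo n g) + (f (suc n) + g (suc n))    ≈⟨ solve 4 (λ a b c d → (a :+ b) :+ (c :+ d) := (a :+ c) :+ (b :+ d)) refl _ _ _ _ ⟩
    (sumTo n f + f (suc n)) + (sumTo n g + g (suc n))    ∎

  *-distribˡ-sumTo : ∀ n a (f : ℕ → Carrier) → a * sumTo n f ≈ sumTo n (λ j → a * f j)
  *-distribˡ-sumTo zero    a f = refl
  *-distribˡ-sumTo (suc n) a f = trans (distribˡ a _ _) (+-congʳ (*-distribˡ-sumTo n a f))

  sumTo-reverse : ∀ n (f : ℕ → Carrier) → sumTo n (λ j → f (n ∸ j)) ≈ sumTo n f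
  sumTo-reverse zero    f = refl
  sumTo-reverse (suc n) f = begin
    sumTo (suc n) (λ j → f (suc n ∸ j))       ≈⟨ sumTo-unfoldˡ n _ ⟩
    f (suc n) + sumTo n (λ j → f (n ∸ j))    ≈⟨ +-comm _ _ ⟩
    sumTo n (λ j → f (n ∸ j)) + f (suc n)    ≈⟨ +-congʳ (sumTo-reverse n f) ⟩
    sumTo n f + f (suc n)                    ∎

  sumTo-extendʳ : ∀ d n (f : ℕ → Carrier) → (∀ j → n ℕ.< j → f j ≈ 0#) → sumTo (d ℕ.+ n) f ≈ sumTo n f
  sumTo-extendʳ zero    n f f≈0 = refl
  sumTo-extendʳ (suc d) n f f≈0 =
    trans (+-cong (sumTo-extendʳ d n f f≈0) (f≈0 (suc (d ℕ.+ n)) (s≤s (ℕP.m≤n+m n d)))) (+-identityʳ _)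

  sumTo-0# : ∀ n (f : ℕ → Carrier) → (∀ j → f j ≈ 0#) → sumTo n f ≈ 0#
  sumTo-0# zero    f f≈0 = f≈0 0
  sumTo-0# (suc n) f f≈0 = trans (+-cong (sumTo-0# n f f≈0) (f≈0 (suc n))) (+-identityʳ 0#)

  altConv : (ℕ → Carrier) → (ℕ → Carrier) → ℕ → Carrier
  altConv c G n = sumTo n (λ m → (- 1#) ^ m * (c m * G (n ∸ m)))

  altConv-zero : ∀ a G → altConv (binomᴿ a) G 0 ≈ G 0
  altConv-zero a G = trans (*-identityˡ _) (trans (*-congʳ ι-1) (*-identityˡ _))

  altConv-binomᴿ[0] : ∀ G n → altConv (binomᴿ (+ 0)) G n ≈ G n
  altConv-binomᴿ[0] G zero    = altConv-zero (+ 0) G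
  altConv-binomᴿ[0] G (suc n) = begin
    altConv (binomᴿ (+ 0)) G (suc n)                                     ≈⟨ sumTo-unfoldˡ n _ ⟩
    1# * (binomᴿ (+ 0) 0 * G (suc n)) + sumTo n (λ m → (- 1#) ^ suc m * (binomᴿ (+ 0) (suc m) * G (n ∸ m)))
      ≈⟨ +-cong (altConv-zero (+ 0) (λ _ → G (suc n))) (sumTo-0# n _ vanish) ⟩
    G (suc n) + 0#                                                       ≈⟨ +-identityʳ _ ⟩
    G (suc n)                                                            ∎
    where
    vanish : ∀ m → (- 1#) ^ suc m * (binomᴿ (+ 0) (suc m) * G (n ∸ m)) ≈ 0#
    vanish m = trans (*-congˡ (trans (*-congʳ (reflexive (P.cong ι (binomℤ[0,1+m]≡0 m)))) (zeroˡ _))) (zeroʳ _)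

  altConv-pascal : ∀ a G n →
    altConv (binomᴿ (sucℤ a)) G (suc n) ≈ altConv (binomᴿ a) G (suc n) - altConv (binomᴿ a) G n
  altConv-pascal a G n = begin
    altConv (binomᴿ (sucℤ a)) G (suc n)                       ≈⟨ sumTo-unfoldˡ n _ ⟩
    t₀ + sumTo n (λ m → (- 1#) ^ suc m * (binomᴿ (sucℤ a) (suc m) * G (n ∸ m)))
                                                               ≈⟨ +-congˡ (sumTo-cong n (λ m _ → split m)) ⟩
    t₀ + sumTo n (λ m → A m + - 1# * B m)                      ≈⟨ +-congˡ (sumTo-distrib-+ n A _) ⟩
    t₀ + (sumTo n A + sumTo n (λ m → - 1# * B m))              ≈⟨ +-congˡ (+-congˡ (*-distribˡ-sumTo n (- 1#) B)) ⟨
    t₀ + (sumTo n A + - 1# * altConv (binomᴿ a) G n)           ≈⟨ +-congˡ (+-congˡ (-1*x≈-x _)) ⟩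
    t₀ + (sumTo n A - altConv (binomᴿ a) G n)                  ≈⟨ +-assoc _ _ _ ⟨
    (t₀ + sumTo n A) - altConv (binomᴿ a) G n                  ≈⟨ +-congʳ (sumTo-unfoldˡ n _) ⟨
    altConv (binomᴿ a) G (suc n) - altConv (binomᴿ a) G n      ∎
    where
    t₀ = 1# * (binomᴿ a 0 * G (suc n))
    A B : ℕ → Carrier
    A m = (- 1#) ^ suc m * (binomᴿ a (suc m) * G (n ∸ m))
    B m = (- 1#) ^ m * (binomᴿ a m * G (n ∸ m))
    split : ∀ m → (- 1#) ^ suc m * (binomᴿ (sucℤ a) (suc m) * G (n ∸ m)) ≈ A m + - 1# * B m
    split m = trans (*-congˡ (*-congʳ (binomᴿ-pascal a m)))
      (solve 5 (λ u v p q g → (u :* v) :* ((p :+ q) :* g) := (u :* v) :* (p :* g) :+ u :* (v :* (q :* g)))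
             refl (- 1#) ((- 1#) ^ m) (binomᴿ a (suc m)) (binomᴿ a m) (G (n ∸ m)))

  *-distribˡ-altConv : ∀ c G n p → p * altConv c G n ≈ altConv c (λ t → p * G t) n
  *-distribˡ-altConv c G n p = trans (*-distribˡ-sumTo n p _) (sumTo-cong n (λ m _ → shuffle _ _ _))
    where
    shuffle : ∀ s b g → p * (s * (b * g)) ≈ s * (b * (p * g))
    shuffle s b g = solve 4 (λ p s b g → p :* (s :* (b :* g)) := s :* (b :* (p :* g))) refl p s b g

  altConv-reflect : ∀ c G n →
    sumTo n (λ j → (- 1#) ^ (n ∸ j) * (c (n ∸ j) * G j)) ≈ altConv c G n
  altConv-reflect c G n = trans (sumTo-cong n reflect) (sumTo-reverse n (λ m → (- 1#) ^ m * (c m * G (n ∸ m))))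
    where
    reflect : ∀ j → j ≤ n → (- 1#) ^ (n ∸ j) * (c (n ∸ j) * G j) ≈ (- 1#) ^ (n ∸ j) * (c (n ∸ j) * G (n ∸ (n ∸ j)))
    reflect j j≤n = reflexive (P.cong (λ i → (- 1#) ^ (n ∸ j) * (c (n ∸ j) * G i)) (P.sym (ℕP.m∸[m∸n]≡n j≤n)))

module FibonacciPolynomials {c ℓ : Level} (R : CommutativeRing c ℓ) (k′ : ℕ.ℕ) (x : CommutativeRing.Carrier R) where
  open CommutativeRing R
  open RingDefs R
  open RingSums R
  open FibonacciArithmetic k′
  open import Data.Nat using (ℕ; zero; suc; _∸_; _≤_; z≤n; s≤s)
  open import Data.Integer using (+_; 1ℤ) renaming (suc to sucℤ; _+_ to _+ℤ_; _-_ to _-ℤ_)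
  import Data.Integer.Properties as ℤP
  open import Data.Integer.Tactic.RingSolver using (solve-∀)
  open import Relation.Binary.PropositionalEquality as P using (_≡_)
  open import Relation.Binary.Reasoning.Setoid setoid
  open import Relation.Nullary using (yes; no)
  open import Algebra.Properties.Semiring.Mult semiring using (_×_; ×-homo-+)
  open import Algebra.Properties.Semiring.Exp semiring using (^-homo-*)
  open import Algebra.Properties.Group +-group using (//-rightDividesˡ; //-rightDividesʳ)
  open import Algebra.Solver.Ring.NaturalCoefficients.Default commutativeSemiring
    using (solve; _:*_; _:=_)

  Fk : ℕ → Carrier
  Fk N = F k N x

  term : ℕ → ℕ → Carrier
  term N j = coeff N j × 1# * x ^ expo N j

  term-0 : ∀ N → term N 0 ≈ x ^ N
  term-0 N = begin
    1 × 1# * x ^ (N ∸ k ℕ.* 0)   ≡⟨ P.cong (λ e → 1 × 1# * x ^ (N ∸ e)) (ℕP.*-zeroʳ k) ⟩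
    1 × 1# * x ^ N             ≈⟨ *-congʳ ι-1 ⟩
    1# * x ^ N                 ≈⟨ *-identityˡ _ ⟩
    x ^ N                      ∎

  term-beyond : ∀ N j → N ℕ./ k ℕ.< j → term N j ≈ 0#
  term-beyond N j N/k<j =
    trans (*-congʳ (reflexive (P.cong (_× 1#) (coeff-beyond N j N/k<j)))) (zeroˡ _)

  F-extend : ∀ N L → N ℕ./ k ≤ L → Fk N ≈ sumTo L (term N)
  F-extend N L N/k≤L = begin
    sumTo (N ℕ./ k) (term N)                   ≈⟨ sumTo-extendʳ (L ∸ N ℕ./ k) (N ℕ./ k) (term N) (term-beyond N) ⟨
    sumTo (L ∸ N ℕ./ k ℕ.+ N ℕ./ k) (term N)       ≡⟨ P.cong (λ M → sumTo M (term N)) (ℕP.m∸n+n≡m N/k≤L) ⟩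
    sumTo L (term N)                         ∎

  F-small : ∀ N → N ℕ.< k → Fk N ≈ x ^ N
  F-small N N<k = trans (reflexive (P.cong (λ L → sumTo L (term N)) (ℕD.m<n⇒m/n≡0 N<k))) (term-0 N)

  x^a*F-small : ∀ a N → N ℕ.< k → x ^ a * Fk N ≈ x ^ (a ℕ.+ N)
  x^a*F-small a N N<k = trans (*-congˡ (F-small N N<k)) (sym (^-homo-* x a N))

  factor-x : ∀ a e → (e ≡ 0 → a ≡ 0) → a × 1# * x ^ e ≈ x * (a × 1# * x ^ (e ∸ 1))
  factor-x a zero    a≡0 rewrite a≡0 P.refl = trans (zeroˡ _) (sym (trans (*-congˡ (zeroˡ _)) (zeroʳ x)))
  factor-x a (suc e) _   = solve 3 (λ c x y → c :* (x :* y) := x :* (c :* y)) refl (a × 1#) x (x ^ e)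

  term-shift : ∀ M j → term (M ℕ.+ k) (suc j) ≈ x * term (M ℕ.+ k′) (suc j) + term M j
  term-shift M j = begin
    coeff (M ℕ.+ k) (suc j) × 1# * x ^ expo (M ℕ.+ k) (suc j)
      ≡⟨ P.cong₂ (λ c e → c × 1# * x ^ e) (coeff-pascal M j) (expo-shift M j) ⟩
    (coeff (M ℕ.+ k′) (suc j) ℕ.+ coeff M j) × 1# * x ^ expo M j
      ≈⟨ trans (*-congʳ (×-homo-+ 1# (coeff (M ℕ.+ k′) (suc j)) (coeff M j))) (distribʳ _ _ _) ⟩
    coeff (M ℕ.+ k′) (suc j) × 1# * x ^ expo M j + coeff M j × 1# * x ^ expo M j
      ≈⟨ +-congʳ (factor-x _ (expo M j) (coeff-expo-0 M j)) ⟩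
    x * (coeff (M ℕ.+ k′) (suc j) × 1# * x ^ (expo M j ∸ 1)) + term M j
      ≡⟨ P.cong (λ e → x * (coeff (M ℕ.+ k′) (suc j) × 1# * x ^ e) + term M j) (P.sym (expo-shift′ M j)) ⟩
    x * term (M ℕ.+ k′) (suc j) + term M j
      ∎

  F-rec : ∀ M → Fk (M ℕ.+ k) ≈ x * Fk (M ℕ.+ k′) + Fk M
  F-rec M = begin
    Fk (M ℕ.+ k)                                                          ≈⟨ F-extend (M ℕ.+ k) (suc L) (ℕP.≤-reflexive [M+k]/k≡1+L) ⟩
    sumTo (suc L) (term (M ℕ.+ k))                                        ≈⟨ sumTo-unfoldˡ L _ ⟩
    term (M ℕ.+ k) 0 + sumTo L (λ j → term (M ℕ.+ k) (suc j))               ≈⟨ +-cong term-0-shift (sumTo-cong L (λ j _ → term-shift M j)) ⟩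
    x * term (M ℕ.+ k′) 0 + sumTo L (λ j → x * term (M ℕ.+ k′) (suc j) + term M j)
                                                                        ≈⟨ +-congˡ (sumTo-distrib-+ L _ _) ⟩
    x * term (M ℕ.+ k′) 0 + (sumTo L (λ j → x * term (M ℕ.+ k′) (suc j)) + Fk M)
                                                                        ≈⟨ +-assoc _ _ _ ⟨
    (x * term (M ℕ.+ k′) 0 + sumTo L (λ j → x * term (M ℕ.+ k′) (suc j))) + Fk M
                                                                        ≈⟨ +-congʳ (sumTo-unfoldˡ L _) ⟨
    sumTo (suc L) (λ j → x * term (M ℕ.+ k′) j) + Fk M                    ≈⟨ +-congʳ (*-distribˡ-sumTo (suc L) x _) ⟨
    x * sumTo (suc L) (term (M ℕ.+ k′)) + Fk M                            ≈⟨ +-congʳ (*-congˡ (F-extend (M ℕ.+ k′) (suc L) [M+k′]/k≤1+L)) ⟨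
    x * Fk (M ℕ.+ k′) + Fk M                                              ∎
    where
    L = M ℕ./ k
    [M+k]/k≡1+L : (M ℕ.+ k) ℕ./ k ≡ suc L
    [M+k]/k≡1+L = P.trans (ℕD.m/n≡1+[m∸n]/n (ℕP.m≤n+m k M)) (P.cong (λ m → suc (m ℕ./ k)) (ℕP.m+n∸n≡m M k))
    [M+k′]/k≤1+L : (M ℕ.+ k′) ℕ./ k ≤ suc L
    [M+k′]/k≤1+L = ℕP.≤-trans (ℕD./-monoˡ-≤ k (ℕP.+-monoʳ-≤ M (ℕP.n≤1+n k′))) (ℕP.≤-reflexive [M+k]/k≡1+L)
    term-0-shift : term (M ℕ.+ k) 0 ≈ x * term (M ℕ.+ k′) 0
    term-0-shift = begin
      term (M ℕ.+ k) 0       ≈⟨ term-0 _ ⟩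
      x ^ (M ℕ.+ k)          ≡⟨ P.cong (x ^_) (ℕP.+-suc M k′) ⟩
      x * x ^ (M ℕ.+ k′)     ≈⟨ *-congˡ (term-0 _) ⟨
      x * term (M ℕ.+ k′) 0  ∎

  x^e*F-rec : ∀ e X s → s ≤ X →
    x ^ e * Fk (k ℕ.+ X ∸ s) ≈ x ^ suc e * Fk (k ℕ.+ X ∸ suc s) + x ^ e * Fk (X ∸ s)
  x^e*F-rec e X s s≤X = begin
    x ^ e * Fk (k ℕ.+ X ∸ s)                                   ≡⟨ P.cong (λ N → x ^ e * Fk N) (shift k) ⟩
    x ^ e * Fk (X ∸ s ℕ.+ k)                                   ≈⟨ *-congˡ (F-rec (X ∸ s)) ⟩
    x ^ e * (x * Fk (X ∸ s ℕ.+ k′) + Fk (X ∸ s))               ≈⟨ distribˡ _ _ _ ⟩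
    x ^ e * (x * Fk (X ∸ s ℕ.+ k′)) + x ^ e * Fk (X ∸ s)       ≈⟨ +-congʳ (solve 3 (λ p x y → p :* (x :* y) := (x :* p) :* y) refl (x ^ e) x _) ⟩
    x ^ suc e * Fk (X ∸ s ℕ.+ k′) + x ^ e * Fk (X ∸ s)         ≡⟨ P.cong (λ N → x ^ suc e * Fk N + x ^ e * Fk (X ∸ s)) (shift k′) ⟨
    x ^ suc e * Fk (k′ ℕ.+ X ∸ s) + x ^ e * Fk (X ∸ s)         ∎
    where
    shift : ∀ a → a ℕ.+ X ∸ s ≡ X ∸ s ℕ.+ a
    shift a = P.trans (ℕP.+-∸-assoc a s≤X) (ℕP.+-comm a (X ∸ s))

  Fk-class : ℕ → ℕ → Carrier
  Fk-class r t = Fk (k ℕ.* t ℕ.+ r)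

  generalFirstIdentity : ∀ r → r ℕ.< k → ∀ n s → s ≤ r ℕ.+ n →
    altConv (binomᴿ (+ s)) (Fk-class r) n ≈ x ^ s * Fk (k ℕ.* n ℕ.+ r ∸ s)
  generalFirstIdentity r r<k zero s s≤r+0 = begin
    altConv (binomᴿ (+ s)) (Fk-class r) 0   ≈⟨ altConv-zero (+ s) (Fk-class r) ⟩
    Fk (k ℕ.* 0 ℕ.+ r)                     ≡⟨ P.cong Fk (k*0+r≡r r) ⟩
    Fk r                                    ≈⟨ F-small r r<k ⟩
    x ^ r                                   ≡⟨ P.cong (x ^_) (ℕP.m+[n∸m]≡n s≤r) ⟨
    x ^ (s ℕ.+ (r ∸ s))                     ≈⟨ x^a*F-small s (r ∸ s) (ℕP.≤-<-trans (ℕP.m∸n≤m r s) r<k) ⟨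
    x ^ s * Fk (r ∸ s)                      ≡⟨ P.cong (λ N → x ^ s * Fk (N ∸ s)) (k*0+r≡r r) ⟨
    x ^ s * Fk (k ℕ.* 0 ℕ.+ r ∸ s)         ∎
    where
    s≤r : s ≤ r
    s≤r = P.subst (s ≤_) (ℕP.+-identityʳ r) s≤r+0
  generalFirstIdentity r r<k (suc n) zero    _ = trans (altConv-binomᴿ[0] (Fk-class r) (suc n)) (sym (*-identityˡ _))
  generalFirstIdentity r r<k (suc n) (suc s) s<r+[1+n] = begin
    altConv (binomᴿ (+ suc s)) (Fk-class r) (suc n)
      ≈⟨ altConv-pascal (+ s) (Fk-class r) n ⟩
    altConv (binomᴿ (+ s)) (Fk-class r) (suc n) - altConv (binomᴿ (+ s)) (Fk-class r) n
      ≈⟨ +-cong (generalFirstIdentity r r<k (suc n) s (ℕP.<⇒≤ s<r+[1+n])) (-‿cong (generalFirstIdentity r r<k n s s≤r+n)) ⟩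
    x ^ s * Fk (k ℕ.* suc n ℕ.+ r ∸ s) - x ^ s * Fk (X ∸ s)
      ≡⟨ P.cong (λ N → x ^ s * Fk (N ∸ s) - x ^ s * Fk (X ∸ s)) (k*[1+n]+r≡k+[k*n+r] n r) ⟩
    x ^ s * Fk (k ℕ.+ X ∸ s) - x ^ s * Fk (X ∸ s)
      ≈⟨ +-congʳ (x^e*F-rec s X s s≤X) ⟩
    (x ^ suc s * Fk (k ℕ.+ X ∸ suc s) + x ^ s * Fk (X ∸ s)) - x ^ s * Fk (X ∸ s)
      ≈⟨ //-rightDividesʳ _ _ ⟩
    x ^ suc s * Fk (k ℕ.+ X ∸ suc s)
      ≡⟨ P.cong (λ N → x ^ suc s * Fk (N ∸ suc s)) (k*[1+n]+r≡k+[k*n+r] n r) ⟨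
    x ^ suc s * Fk (k ℕ.* suc n ℕ.+ r ∸ suc s)
      ∎
    where
    X = k ℕ.* n ℕ.+ r
    s≤r+n : s ≤ r ℕ.+ n
    s≤r+n = ℕP.≤-pred (P.subst (s ℕ.<_) (ℕP.+-suc r n) s<r+[1+n])
    s≤X : s ≤ X
    s≤X = ℕP.≤-trans s≤r+n (ℕP.≤-trans (ℕP.+-monoʳ-≤ r (ℕP.m≤n*m n k)) (ℕP.≤-reflexive (ℕP.+-comm r (k ℕ.* n))))

  firstIdentity : ∀ r → r ℕ.< k → ∀ n → 1 ≤ n →
    altConv (binomᴿ (+ (r ℕ.+ 1))) (Fk-class r) n ≈ x ^ (r ℕ.+ 1) * Fk (k ℕ.* n ∸ 1)
  firstIdentity r r<k n 1≤n =
    trans (generalFirstIdentity r r<k n (r ℕ.+ 1) (ℕP.+-monoʳ-≤ r 1≤n)) (reflexive (P.cong (λ N → x ^ (r ℕ.+ 1) * Fk N) index))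
    where
    index : k ℕ.* n ℕ.+ r ∸ (r ℕ.+ 1) ≡ k ℕ.* n ∸ 1
    index = P.trans (P.cong (_∸ (r ℕ.+ 1)) (ℕP.+-comm (k ℕ.* n) r)) (ℕP.[m+n]∸[m+o]≡n∸o r (k ℕ.* n) 1)

  -- The second identity at n + 1, with the order of summation reversed.
  SecondIdentity : ℕ → ℕ → ℕ → Set ℓ
  SecondIdentity r n i =
    altConv (binomᴿ (+ i -ℤ + k +ℤ + r)) (λ t → x ^ k * Fk-class r t) n ≈ x ^ (r ℕ.+ i) * Fk (k ℕ.* suc n ∸ i)

  secondIdentity-upper : ∀ r → r ℕ.< k → ∀ n s → k ∸ r ℕ.+ s ℕ.< k ℕ.+ suc n →
    SecondIdentity r n (k ∸ r ℕ.+ s)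
  secondIdentity-upper r r<k n s i<k+[1+n] = begin
    altConv (binomᴿ (+ (k ∸ r ℕ.+ s) -ℤ + k +ℤ + r)) (λ t → x ^ k * Fk-class r t) n
      ≡⟨ P.cong (λ a → altConv (binomᴿ a) (λ t → x ^ k * Fk-class r t) n) offset≡s ⟩
    altConv (binomᴿ (+ s)) (λ t → x ^ k * Fk-class r t) n
      ≈⟨ *-distribˡ-altConv (binomᴿ (+ s)) (Fk-class r) n (x ^ k) ⟨
    x ^ k * altConv (binomᴿ (+ s)) (Fk-class r) n
      ≈⟨ *-congˡ (generalFirstIdentity r r<k n s s≤r+n) ⟩
    x ^ k * (x ^ s * Fk (k ℕ.* n ℕ.+ r ∸ s))
      ≈⟨ trans (*-congʳ (^-homo-* x k s)) (*-assoc _ _ _) ⟨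
    x ^ (k ℕ.+ s) * Fk (k ℕ.* n ℕ.+ r ∸ s)
      ≡⟨ P.cong₂ (λ e N → x ^ e * Fk N) exponent index ⟩
    x ^ (r ℕ.+ (k ∸ r ℕ.+ s)) * Fk (k ℕ.* suc n ∸ (k ∸ r ℕ.+ s))
      ∎
    where
    r≤k = ℕP.<⇒≤ r<k
    offset≡s : + (k ∸ r ℕ.+ s) -ℤ + k +ℤ + r ≡ + s
    offset≡s = P.trans (P.cong (λ a → a +ℤ + s -ℤ + k +ℤ + r) (P.trans (P.sym (ℤP.⊖-≥ r≤k)) (P.sym (ℤP.[+m]-[+n]≡m⊖n k r))))
                       (cancel (+ k) (+ r) (+ s))
      where
      cancel : ∀ k r s → (k -ℤ r +ℤ s) -ℤ k +ℤ r ≡ s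
      cancel = solve-∀
    s≤r+n : s ≤ r ℕ.+ n
    s≤r+n = ℕP.+-cancelˡ-≤ (k ∸ r) s (r ℕ.+ n)
      (P.subst (k ∸ r ℕ.+ s ≤_) (P.trans (P.cong (ℕ._+ n) (P.sym (ℕP.m∸n+n≡m r≤k))) (ℕP.+-assoc (k ∸ r) r n))
        (ℕP.≤-pred (P.subst (k ∸ r ℕ.+ s ℕ.<_) (ℕP.+-suc k n) i<k+[1+n])))
    exponent : k ℕ.+ s ≡ r ℕ.+ (k ∸ r ℕ.+ s)
    exponent = P.trans (P.cong (ℕ._+ s) (P.sym (ℕP.m+[n∸m]≡n r≤k))) (ℕP.+-assoc r (k ∸ r) s)
    index : k ℕ.* n ℕ.+ r ∸ s ≡ k ℕ.* suc n ∸ (k ∸ r ℕ.+ s)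
    index = P.trans (P.cong (_∸ s) (P.sym (k*[1+n]∸[k∸r]≡k*n+r n r r≤k))) (ℕP.∸-+-assoc (k ℕ.* suc n) (k ∸ r) s)

  i+d≡k∸r⇒i≤k : ∀ r i d → i ℕ.+ d ≡ k ∸ r → i ≤ k
  i+d≡k∸r⇒i≤k r i d i+d≡k∸r = ℕP.≤-trans (P.subst (i ≤_) i+d≡k∸r (ℕP.m≤m+n i d)) (ℕP.m∸n≤m k r)

  secondIdentity-lower : ∀ r → r ℕ.< k → ∀ n d i → 0 ℕ.< i → i ℕ.+ d ≡ k ∸ r → SecondIdentity r n i
  secondIdentity-lower r r<k n zero i _ i+0≡k∸r =
    P.subst (SecondIdentity r n) i≡k∸r+0 (secondIdentity-upper r r<k n 0 k∸r+0<k+[1+n])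
    where
    i≡k∸r+0 : k ∸ r ℕ.+ 0 ≡ i
    i≡k∸r+0 = P.trans (ℕP.+-identityʳ (k ∸ r)) (P.trans (P.sym i+0≡k∸r) (ℕP.+-identityʳ i))
    k∸r+0<k+[1+n] : k ∸ r ℕ.+ 0 ℕ.< k ℕ.+ suc n
    k∸r+0<k+[1+n] = P.subst (ℕ._< k ℕ.+ suc n) (P.sym i≡k∸r+0) (ℕP.≤-<-trans (i+d≡k∸r⇒i≤k r i 0 i+0≡k∸r) (ℕP.m<m+n k (s≤s z≤n)))
  secondIdentity-lower r r<k zero (suc d) i@(suc i′) _ i+[1+d]≡k∸r = begin
    altConv (binomᴿ (+ i -ℤ + k +ℤ + r)) (λ t → x ^ k * Fk-class r t) 0
                                                 ≈⟨ altConv-zero (+ i -ℤ + k +ℤ + r) (λ t → x ^ k * Fk-class r t) ⟩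
    x ^ k * Fk (k ℕ.* 0 ℕ.+ r)                   ≡⟨ P.cong (λ N → x ^ k * Fk N) (k*0+r≡r r) ⟩
    x ^ k * Fk r                                 ≈⟨ x^a*F-small k r r<k ⟩
    x ^ (k ℕ.+ r)                                ≡⟨ P.cong (x ^_) exponent ⟩
    x ^ (r ℕ.+ i ℕ.+ (k ∸ i))                    ≈⟨ x^a*F-small (r ℕ.+ i) (k′ ∸ i′) (s≤s (ℕP.m∸n≤m k′ i′)) ⟨
    x ^ (r ℕ.+ i) * Fk (k ∸ i)                   ≡⟨ P.cong (λ N → x ^ (r ℕ.+ i) * Fk (N ∸ i)) (ℕP.*-identityʳ k) ⟨
    x ^ (r ℕ.+ i) * Fk (k ℕ.* 1 ∸ i)             ∎
    where
    exponent : k ℕ.+ r ≡ r ℕ.+ i ℕ.+ (k ∸ i)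
    exponent = P.trans (ℕP.+-comm k r) (P.trans (P.cong (r ℕ.+_) (P.sym (ℕP.m+[n∸m]≡n (i+d≡k∸r⇒i≤k r i (suc d) i+[1+d]≡k∸r))))
                                               (P.sym (ℕP.+-assoc r i (k ∸ i))))
  secondIdentity-lower r r<k (suc n) (suc d) i 0<i i+[1+d]≡k∸r = begin
    altConv (binomᴿ a) G (suc n)
      ≈⟨ //-rightDividesˡ (altConv (binomᴿ a) G n) _ ⟨
    (altConv (binomᴿ a) G (suc n) - altConv (binomᴿ a) G n) + altConv (binomᴿ a) G n
      ≈⟨ +-congʳ (altConv-pascal a G n) ⟨
    altConv (binomᴿ (sucℤ a)) G (suc n) + altConv (binomᴿ a) G n
      ≡⟨ P.cong (λ b → altConv (binomᴿ b) G (suc n) + altConv (binomᴿ a) G n) (offset-suc (+ i) (+ k) (+ r)) ⟨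
    altConv (binomᴿ (+ suc i -ℤ + k +ℤ + r)) G (suc n) + altConv (binomᴿ a) G n
      ≈⟨ +-cong (secondIdentity-lower r r<k (suc n) d (suc i) (s≤s z≤n) (P.trans (P.sym (ℕP.+-suc i d)) i+[1+d]≡k∸r))
                (secondIdentity-lower r r<k n (suc d) i 0<i i+[1+d]≡k∸r) ⟩
    x ^ (r ℕ.+ suc i) * Fk (k ℕ.* suc (suc n) ∸ suc i) + x ^ (r ℕ.+ i) * Fk (X ∸ i)
      ≡⟨ P.cong₂ (λ e N → x ^ e * Fk (N ∸ suc i) + x ^ (r ℕ.+ i) * Fk (X ∸ i)) (ℕP.+-suc r i) (ℕP.*-suc k (suc n)) ⟩
    x ^ suc (r ℕ.+ i) * Fk (k ℕ.+ X ∸ suc i) + x ^ (r ℕ.+ i) * Fk (X ∸ i)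
      ≈⟨ x^e*F-rec (r ℕ.+ i) X i i≤X ⟨
    x ^ (r ℕ.+ i) * Fk (k ℕ.+ X ∸ i)
      ≡⟨ P.cong (λ N → x ^ (r ℕ.+ i) * Fk (N ∸ i)) (ℕP.*-suc k (suc n)) ⟨
    x ^ (r ℕ.+ i) * Fk (k ℕ.* suc (suc n) ∸ i)
      ∎
    where
    a = + i -ℤ + k +ℤ + r
    G = λ t → x ^ k * Fk-class r t
    X = k ℕ.* suc n
    offset-suc : ∀ a b c → (1ℤ +ℤ a) -ℤ b +ℤ c ≡ 1ℤ +ℤ (a -ℤ b +ℤ c)
    offset-suc = solve-∀
    i≤X : i ≤ X
    i≤X = ℕP.≤-trans (i+d≡k∸r⇒i≤k r i (suc d) i+[1+d]≡k∸r) (ℕP.m≤m*n k (suc n))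

  secondIdentity : ∀ r → r ℕ.< k → ∀ n i → 0 ℕ.< i → i ℕ.< k ℕ.+ suc n → SecondIdentity r n i
  secondIdentity r r<k n i 0<i i<k+[1+n] with k ∸ r ℕP.≤? i
  ... | yes k∸r≤i = P.subst (SecondIdentity r n) (ℕP.m+[n∸m]≡n k∸r≤i)
    (secondIdentity-upper r r<k n (i ∸ (k ∸ r)) (P.subst (ℕ._< k ℕ.+ suc n) (P.sym (ℕP.m+[n∸m]≡n k∸r≤i)) i<k+[1+n]))
  ... | no  k∸r≰i = secondIdentity-lower r r<k n (k ∸ r ∸ i) i 0<i (ℕP.m+[n∸m]≡n (ℕP.<⇒≤ (ℕP.≰⇒> k∸r≰i)))

open import Data.Nat using (ℕ; _+_; _*_; _∸_; _<_; _≤_; NonZero)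
open import Data.Integer using (+_; _-_) renaming (_+_ to _+ℤ_)
open import Data.Product using (_×_; _,_)

lemma10 : {c ℓ : Level} (R : CommutativeRing c ℓ) →
  let module R = CommutativeRing R
      open RingDefs R
  in (k : ℕ) .{{_ : NonZero k}} (r n : ℕ) → r < k → 1 ≤ n → (x : R.Carrier) →
     (sumTo n (λ j → ((R.- R.1#) ^ j)
                     R.* (ι (binomℤ (+ (r + 1)) j) R.* F k (k * (n ∸ j) + r) x))
        R.≈ (x ^ (r + 1)) R.* F k (k * n ∸ 1) x)
     × ((i : ℕ) → 0 < i → i < k + n →
        sumTo (n ∸ 1) (λ j → ((R.- R.1#) ^ (n ∸ 1 ∸ j))
                             R.* (ι (binomℤ (+ i - + k +ℤ + r) (n ∸ 1 ∸ j))
                             R.* ((x ^ k) R.* F k (k * j + r) x)))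
          R.≈ (x ^ (r + i)) R.* F k (k * n ∸ i) x)
lemma10 R (ℕ.suc k′) r (ℕ.suc n) r<k 1≤n x =
    firstIdentity r r<k (ℕ.suc n) 1≤n
  , λ i 0<i i<k+n → R.trans (altConv-reflect _ (λ t → x ^ (ℕ.suc k′) R.* Fk-class r t) n) (secondIdentity r r<k n i 0<i i<k+n)
  where
  module R = CommutativeRing R
  open RingDefs R
  open RingSums R
  open FibonacciPolynomials R k′ x
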